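{- Let $M^c=\langle W^c,\le^c,F^c,R^c,V^c\rangle$ be the canonical birelational model for $\mathsf{CK}$. Then for every $(\Phi,\mathcal U)\in W^c$ and every formula $A$ of $\mathcal L$, $(\Phi,\mathcal U)\Vdash A$ if and only if $A\in\Phi$. Moreover, $M^c$ is a constructive birelational model.
   Context: $\mathcal L$ is the language $A ::= p \mid \bot \mid A\wedge A \mid A\vee A \mid A\to A \mid \Box A \mid \Diamond A$ over a countable set $\mathrm{Atm}$. $\mathsf{MPL}$ is axiomatised by $A\wedge B\to A$, $A\wedge B\to B$, $A\to A\vee B$, $B\to A\vee B$, $(A\to B)\to((A\to C)\to(A\to B\wedge C))$, $(A\to C)\to((B\to C)\to(A\vee B\to C))$, $(A\to(B\to C))\to((A\to B)\to(A\to C))$, $A\to(B\to A)$, and modus ponens. $\mathsf{CK}$ extends $\mathsf{MPL}$ with $\bot\to A$, $\Box(A\to B)\to(\Box A\to\Box B)$, $\Box(A\to B)\to(\Diamond A\to\Diamond B)$, and the rule $A/\Box A$. $\Phi\vdash_{\mathsf{CK}}A$ means there are $B_1,\dots,B_n\in\Phi$ with $B_1\wedge\dots\wedge B_n\to A$ derivable in $\mathsf{CK}$. $\Phi$ is $\mathsf{CK}$-full if closed under $\vdash_{\mathsf{CK}}$ and $A\vee B\in\Phi$ implies $A\in\Phi$ or $B\in\Phi$. A $\mathsf{CK}$-relational segment is $(\Phi,\mathcal U)$ with $\Phi$ $\mathsf{CK}$-full, $\mathcal U$ a set of $\mathsf{CK}$-full sets, such that $\Box A\in\Phi$ implies $A\in\Psi$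 for all $\Psi\in\mathcal U$, and $\Diamond A\in\Phi$ implies $A\in\Psi$ for some $\Psi\in\mathcal U$. Canonical model: $W^c$ = all $\mathsf{CK}$-relational segments; $(\Phi,\mathcal U)\le^c(\Psi,\mathcal V)$ iff $\Phi\subseteq\Psi$; $(\Phi,\mathcal U)\in F^c$ iff $\bot\in\Phi$; $(\Phi,\mathcal U)R^c(\Psi,\mathcal V)$ iff $\Psi\in\mathcal U$; $(\Phi,\mathcal U)\in V^c(p)$ iff $p\in\Phi$. Forcing: $w\Vdash p$ iff $w\in V^c(p)$; $w\Vdash\bot$ iff $w\in F^c$; $\wedge,\vee$ pointwise; $w\Vdash B\to C$ iff for all $v\ge^c w$, $v\Vdash B$ implies $v\Vdash C$; $w\Vdash\Box B$ iff for all $v\ge^c w$ and $u$ with $vR^cu$, $u\Vdash B$; $w\Vdash\Diamond B$ iff for all $v\ge^cw$ there is $u$ with $vR^cu$ and $u\Vdash B$. A constructive birelational model is a tuple $\langle W,\le,F,R,V\rangle$ with $W\ne\emptyset$, $\le$ reflexive transitive, $F$ and each $V(p)$ upward closed, $R$ a binary relation, such that for every $w\in F$: (i) $w\in V(p)$ for all $p\in\mathrm{Atm}$; (ii) $wRv$ implies $v\in F$; (iii) there is $v$ with $wRv$. -}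

module Defs where

open import Level using (Level; _⊔_; Lift) renaming (suc to lsuc; zero to lzero)
open import Data.Nat using (ℕ)
open import Data.List using (List; []; _∷_)
open import Data.List.Relation.Unary.All using (All)
open import Data.Product using (Σ; _×_; _,_; ∃)
open import Data.Sum using (_⊎_)
open import Relation.Nullary using (¬_)

Atm : Set
Atm = ℕ

infixr 30 _∧_
infixr 20 _∨_
infixr 10 _⇒_

data Fm : Set where
  var  : Atm → Fm
  ⊥'   : Fm
  _∧_  : Fm → Fm → Fm
  _∨_  : Fm → Fm → Fm
  _⇒_  : Fm → Fm → Fm
  □    : Fm → Fm
  ◇    : Fm → Fm

data CK⊢_ : Fm → Set where
  ax∧₁  : ∀ {A B} → CK⊢ (A ∧ B ⇒ A)
  ax∧₂  : ∀ {A B} → CK⊢ (A ∧ B ⇒ B)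
  ax∨₁  : ∀ {A B} → CK⊢ (A ⇒ A ∨ B)
  ax∨₂  : ∀ {A B} → CK⊢ (B ⇒ A ∨ B)
  ax∧I  : ∀ {A B C} → CK⊢ ((A ⇒ B) ⇒ ((A ⇒ C) ⇒ (A ⇒ B ∧ C)))
  ax∨E  : ∀ {A B C} → CK⊢ ((A ⇒ C) ⇒ ((B ⇒ C) ⇒ (A ∨ B ⇒ C)))
  axS   : ∀ {A B C} → CK⊢ ((A ⇒ (B ⇒ C)) ⇒ ((A ⇒ B) ⇒ (A ⇒ C)))
  axK   : ∀ {A B} → CK⊢ (A ⇒ (B ⇒ A))
  ax⊥   : ∀ {A} → CK⊢ (⊥' ⇒ A)
  axK□  : ∀ {A B} → CK⊢ (□ (A ⇒ B) ⇒ (□ A ⇒ □ B))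
  axK◇  : ∀ {A B} → CK⊢ (□ (A ⇒ B) ⇒ (◇ A ⇒ ◇ B))
  mp    : ∀ {A B} → CK⊢ (A ⇒ B) → CK⊢ A → CK⊢ B
  nec   : ∀ {A} → CK⊢ A → CK⊢ □ A

FmSet : Set₁
FmSet = Fm → Set

conj : Fm → List Fm → Fm
conj B []       = B
conj B (C ∷ Cs) = B ∧ conj C Cs

-- Φ ⊢CK A : there are B₁,…,Bₙ ∈ Φ with ⊢CK B₁ ∧ … ∧ Bₙ → A.
-- The case n = 0 (empty conjunction) is read as ⊢CK A.
_⊢CK_ : FmSet → Fm → Set
Φ ⊢CK A = (CK⊢ A) ⊎ Σ Fm λ B → Σ (List Fm) λ Bs →
            All Φ (B ∷ Bs) × (CK⊢ (conj B Bs ⇒ A))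

record Full (Φ : FmSet) : Set where
  field
    closed : ∀ A → Φ ⊢CK A → Φ A
    prime  : ∀ A B → Φ (A ∨ B) → Φ A ⊎ Φ B

record Segment : Set₁ where
  field
    Φ      : FmSet
    𝒰      : FmSet → Set
    Φ-full : Full Φ
    𝒰-full : ∀ Ψ → 𝒰 Ψ → Full Ψ
    □-cond : ∀ A → Φ (□ A) → ∀ Ψ → 𝒰 Ψ → Ψ A
    ◇-cond : ∀ A → Φ (◇ A) → Σ FmSet λ Ψ → 𝒰 Ψ × Ψ A

open Segment public

Wᶜ : Set₁
Wᶜ = Segment

_≤ᶜ_ : Wᶜ → Wᶜ → Set
w ≤ᶜ v = ∀ A → Φ w A → Φ v A

Fᶜ : Wᶜ → Set
Fᶜ w = Φ w ⊥'

Rᶜ : Wᶜ → Wᶜ → Set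
Rᶜ w v = 𝒰 w (Φ v)

Vᶜ : Atm → Wᶜ → Set
Vᶜ p w = Φ w (var p)

_⊩_ : Wᶜ → Fm → Set₁
w ⊩ var p = Lift _ (Vᶜ p w)
w ⊩ ⊥'    = Lift _ (Fᶜ w)
w ⊩ (B ∧ C) = (w ⊩ B) × (w ⊩ C)
w ⊩ (B ∨ C) = (w ⊩ B) ⊎ (w ⊩ C)
w ⊩ (B ⇒ C) = ∀ v → w ≤ᶜ v → v ⊩ B → v ⊩ C
w ⊩ □ B   = ∀ v → w ≤ᶜ v → ∀ u → Rᶜ v u → u ⊩ B
w ⊩ ◇ B   = ∀ v → w ≤ᶜ v → Σ Wᶜ λ u → Rᶜ v u × (u ⊩ B)

record IsConstructiveBirelational {a b c d e : Level} (W : Set a)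
       (_≤_ : W → W → Set b) (F : W → Set c) (R : W → W → Set d)
       (V : Atm → W → Set e) : Set (a ⊔ b ⊔ c ⊔ d ⊔ e) where
  field
    nonempty  : W
    ≤-refl    : ∀ w → w ≤ w
    ≤-trans   : ∀ u v w → u ≤ v → v ≤ w → u ≤ w
    F-up      : ∀ w v → w ≤ v → F w → F v
    V-up      : ∀ p w v → w ≤ v → V p w → V p v
    F-atoms   : ∀ w → F w → ∀ p → V p w
    F-R       : ∀ w → F w → ∀ v → R w v → F v
    F-serial  : ∀ w → F w → Σ W λ v → R w v

-- The cases ∧, ∨, var and ⊥ are
-- closure and primeness of Φ. For ⇒, □ and ◇ a missing formula yields a refuting
-- segment: a Lindenbaum extension of Φ ∪ {B} avoiding C refutes B ⇒ C, one of □⁻¹Φ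
-- avoiding B refutes □B, and for ◇B the segment on Φ whose successors are all full sets
-- containing □⁻¹Φ and avoiding B is still a segment, since ◇A ∈ Φ makes □⁻¹Φ ∪ {A}
-- consistent with ¬B (otherwise ◇B ∈ Φ by the ◇-axiom). Lindenbaum's construction
-- uses excluded middle and an injective coding of formulas. That M^c is a constructive
-- birelational model follows from ⊥ → A.
module Submission where

open import Defs
open import Level using (lift; lower) renaming (zero to lzero)
open import Axiom.ExcludedMiddle using (ExcludedMiddle)
open import Axiom.DoubleNegationElimination using (em⇒dne)
open import Data.Empty using (⊥-elim)
open import Data.List using (List; []; _∷_)
open import Data.List.Properties using (∷-injectiveˡ)
open import Data.List.Relation.Unary.All using (All; []; _∷_)
open import Data.Nat using (ℕ; zero; suc; _+_; _⊔_; _≤′_; ≤′-refl; ≤′-step)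
open import Data.Nat.Binary using (ℕᵇ; 2[1+_]; 1+[2_]; toℕ) renaming (zero to 0ᵇ)
open import Data.Nat.Binary.Properties using (toℕ-injective)
open import Data.Nat.Properties using (+-suc; +-identityʳ; ≤⇒≤′; m≤m⊔n; m≤n⊔m)
open import Data.Product using (Σ; _×_; _,_; proj₁; proj₂)
open import Data.Sum as Sum using (_⊎_; inj₁; inj₂)
open import Data.Unit using (tt)
open import Function.Base using (id; _∘_)
open import Function.Bundles using (_⇔_; mk⇔; Equivalence)
open import Relation.Binary.PropositionalEquality using (_≡_; refl; sym; trans; cong)
open import Relation.Nullary using (¬_; yes; no)
open import Relation.Unary using (_⊆_; _∪_; ｛_｝; ∅; U; ⋃)

-- A formula is written in reverse Polish notation, the k-th symbol as the binary
-- word 1ᵏ0 (least significant digit first); a stack machine reads it back.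

symbol : ℕ → ℕᵇ → ℕᵇ
symbol zero    r = 2[1+ r ]
symbol (suc k) r = 1+[2 symbol k r ]

write : Fm → ℕᵇ → ℕᵇ
write (var p) = symbol (6 + p)
write ⊥'      = symbol 0
write (A ∧ B) r = write A (write B (symbol 1 r))
write (A ∨ B) r = write A (write B (symbol 2 r))
write (A ⇒ B) r = write A (write B (symbol 3 r))
write (□ A)   r = write A (symbol 4 r)
write (◇ A)   r = write A (symbol 5 r)

push : ℕ → List Fm → List Fm
push 0 s = ⊥' ∷ s
push 1 (B ∷ A ∷ s) = A ∧ B ∷ s
push 2 (B ∷ A ∷ s) = A ∨ B ∷ s
push 3 (B ∷ A ∷ s) = A ⇒ B ∷ s
push 4 (A ∷ s) = □ A ∷ s
push 5 (A ∷ s) = ◇ A ∷ s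
push (suc (suc (suc (suc (suc (suc p)))))) s = var p ∷ s
push _ s = s

read : ℕ → List Fm → ℕᵇ → List Fm
read k s 0ᵇ = s
read k s 2[1+ r ] = read 0 (push k s) r
read k s 1+[2 r ] = read (suc k) s r

read-symbol-+ : ∀ j k s r → read k s (symbol j r) ≡ read 0 (push (j + k) s) r
read-symbol-+ zero    k s r = refl
read-symbol-+ (suc j) k s r =
  trans (read-symbol-+ j (suc k) s r) (cong (λ n → read 0 (push n s) r) (+-suc j k))

read-symbol : ∀ j s r → read 0 s (symbol j r) ≡ read 0 (push j s) r
read-symbol j s r =
  trans (read-symbol-+ j 0 s r) (cong (λ n → read 0 (push n s) r) (+-identityʳ j))

read-write : ∀ A s r → read 0 s (write A r) ≡ read 0 (A ∷ s) r
read-write (var p) s r = read-symbol (6 + p) s r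
read-write ⊥'      s r = read-symbol 0 s r
read-write (A ∧ B) s r =
  trans (read-write A s _) (trans (read-write B _ _) (read-symbol 1 (B ∷ A ∷ s) r))
read-write (A ∨ B) s r =
  trans (read-write A s _) (trans (read-write B _ _) (read-symbol 2 (B ∷ A ∷ s) r))
read-write (A ⇒ B) s r =
  trans (read-write A s _) (trans (read-write B _ _) (read-symbol 3 (B ∷ A ∷ s) r))
read-write (□ A) s r = trans (read-write A s _) (read-symbol 4 (A ∷ s) r)
read-write (◇ A) s r = trans (read-write A s _) (read-symbol 5 (A ∷ s) r)

code : Fm → ℕ
code A = toℕ (write A 0ᵇ)

code-injective : ∀ {A B} → code A ≡ code B → A ≡ B
code-injective {A} {B} e = ∷-injectiveˡ (trans (sym (read-write A [] 0ᵇ))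
  (trans (cong (read 0 []) (toℕ-injective {write A 0ᵇ} {write B 0ᵇ} e)) (read-write B [] 0ᵇ)))

infix 4 _⊢_

data _⊢_ (Γ : FmSet) : Fm → Set where
  hyp : ∀ {A} → Γ A → Γ ⊢ A
  ax  : ∀ {A} → CK⊢ A → Γ ⊢ A
  mp  : ∀ {A B} → Γ ⊢ A ⇒ B → Γ ⊢ A → Γ ⊢ B

weaken : ∀ {Γ Δ A} → Γ ⊆ Δ → Γ ⊢ A → Δ ⊢ A
weaken Γ⊆Δ (hyp x)  = hyp (Γ⊆Δ x)
weaken Γ⊆Δ (ax c)   = ax c
weaken Γ⊆Δ (mp d e) = mp (weaken Γ⊆Δ d) (weaken Γ⊆Δ e)

∅⊢⇒CK⊢ : ∀ {A} → ∅ ⊢ A → CK⊢ A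
∅⊢⇒CK⊢ (ax c)   = c
∅⊢⇒CK⊢ (mp d e) = mp (∅⊢⇒CK⊢ d) (∅⊢⇒CK⊢ e)

CK⊢-id : ∀ {A} → CK⊢ (A ⇒ A)
CK⊢-id {A} = mp (mp (axS {A} {A ⇒ A} {A}) axK) axK

deduction : ∀ {Γ A B} → Γ ∪ ｛ A ｝ ⊢ B → Γ ⊢ A ⇒ B
deduction (hyp (inj₁ x))    = mp (ax axK) (hyp x)
deduction (hyp (inj₂ refl)) = ax CK⊢-id
deduction (ax c)            = mp (ax axK) (ax c)
deduction (mp d e)          = mp (mp (ax axS) (deduction d)) (deduction e)

∧-intro : ∀ {Γ A B} → Γ ⊢ A → Γ ⊢ B → Γ ⊢ A ∧ B
∧-intro a b = mp (mp (mp (ax ax∧I) (mp (ax axK) a)) (mp (ax axK) b)) a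

conj-intro : ∀ {Γ} B Bs → All Γ (B ∷ Bs) → Γ ⊢ conj B Bs
conj-intro B []       (x ∷ [])  = hyp x
conj-intro B (C ∷ Cs) (x ∷ xs) = ∧-intro (hyp x) (conj-intro C Cs xs)

⊢CK⇒⊢ : ∀ {Γ A} → Γ ⊢CK A → Γ ⊢ A
⊢CK⇒⊢ (inj₁ c)                = ax c
⊢CK⇒⊢ (inj₂ (B , Bs , xs , c)) = mp (ax c) (conj-intro B Bs xs)

□⁻¹ : FmSet → FmSet
□⁻¹ Γ A = Γ (□ A)

□-intro : ∀ {Γ A} → □⁻¹ Γ ⊢ A → Γ ⊢ □ A
□-intro (hyp x)  = hyp x
□-intro (ax c)   = ax (nec c)
□-intro (mp d e) = mp (mp (ax axK□) (□-intro d)) (□-intro e)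

◇-intro : ∀ {Γ A B} → □⁻¹ Γ ∪ ｛ A ｝ ⊢ B → Γ (◇ A) → Γ ⊢ ◇ B
◇-intro d ◇A = mp (mp (ax axK◇) (□-intro (deduction d))) (hyp ◇A)

module _ {Φ : FmSet} (full : Full Φ) where

  full-⊢ : ∀ {A} → Φ ⊢ A → Φ A
  full-⊢ (hyp x)  = x
  full-⊢ (ax c)   = Full.closed full _ (inj₁ c)
  full-⊢ (mp {A} {B} d e) =
    Full.closed full B (inj₂ (A ⇒ B , A ∷ [] , full-⊢ d ∷ full-⊢ e ∷ [] , modus-ponens))
    where
    modus-ponens : CK⊢ ((A ⇒ B) ∧ A ⇒ B)
    modus-ponens = ∅⊢⇒CK⊢ (deduction (mp (mp (ax ax∧₁) (hyp (inj₂ refl)))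
                                         (mp (ax ax∧₂) (hyp (inj₂ refl)))))

  full-explosion : ∀ {A} → Φ ⊥' → Φ A
  full-explosion x = full-⊢ (mp (ax ax⊥) (hyp x))

full-U : Full U
full-U = record { closed = λ _ _ → tt ; prime = λ _ _ _ → inj₁ tt }

record FullExtension (Γ : FmSet) (C : Fm) : Set₁ where
  field
    Ψ       : FmSet
    full    : Full Ψ
    extends : Γ ⊆ Ψ
    avoids  : ¬ Ψ C

module Lindenbaum (em : ExcludedMiddle lzero) (Γ : FmSet) (C : Fm) (Γ⊬C : ¬ Γ ⊢ C) where

  Admissible : ℕ → FmSet → Fm → Set
  Admissible n Δ X = code X ≡ n × ¬ Δ ∪ ｛ X ｝ ⊢ C

  stage : ℕ → FmSet
  stage zero    = Γ
  stage (suc n) X = stage n X ⊎ Admissible n (stage n) X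

  Ψ : FmSet
  Ψ = ⋃ ℕ stage

  stage-mono : ∀ {m n} → m ≤′ n → stage m ⊆ stage n
  stage-mono ≤′-refl        = id
  stage-mono (≤′-step m≤′n) = inj₁ ∘ stage-mono m≤′n

  stage-suc⊆ : ∀ {n X} → Admissible n (stage n) X → stage (suc n) ⊆ stage n ∪ ｛ X ｝
  stage-suc⊆ a (inj₁ x)      = inj₁ x
  stage-suc⊆ a (inj₂ (c , _)) = inj₂ (code-injective (trans (proj₁ a) (sym c)))

  stage-consistent : ∀ n → ¬ stage n ⊢ C
  stage-consistent zero = Γ⊬C
  stage-consistent (suc n) d with em {Σ Fm (Admissible n (stage n))}
  ... | yes (X , a) = proj₂ a (weaken (stage-suc⊆ a) d)
  ... | no none     = stage-consistent n (weaken only-old d)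
    where
    only-old : stage (suc n) ⊆ stage n
    only-old (inj₁ x) = x
    only-old (inj₂ a) = ⊥-elim (none (_ , a))

  compact : ∀ {A} → Ψ ⊢ A → Σ ℕ λ n → stage n ⊢ A
  compact (hyp (n , x)) = n , hyp x
  compact (ax c)        = 0 , ax c
  compact (mp d e) with compact d | compact e
  ... | m , d′ | n , e′ =
    m ⊔ n , mp (weaken (stage-mono (≤⇒≤′ (m≤m⊔n m n))) d′)
               (weaken (stage-mono (≤⇒≤′ (m≤n⊔m m n))) e′)

  Ψ-consistent : ¬ Ψ ⊢ C
  Ψ-consistent d = let n , d′ = compact d in stage-consistent n d′

  Ψ∪-consistent⇒∈ : ∀ {A} → ¬ Ψ ∪ ｛ A ｝ ⊢ C → Ψ A
  Ψ∪-consistent⇒∈ {A} ¬d = suc (code A) , inj₂ (refl , ¬d ∘ weaken stage⊆Ψ)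
    where
    stage⊆Ψ : stage (code A) ∪ ｛ A ｝ ⊆ Ψ ∪ ｛ A ｝
    stage⊆Ψ = Sum.map (code A ,_) id

  ∉Ψ⇒derives : ∀ {A} → ¬ Ψ A → Ψ ⊢ A ⇒ C
  ∉Ψ⇒derives ∉Ψ = deduction (em⇒dne em (∉Ψ ∘ Ψ∪-consistent⇒∈))

  Ψ-closed : ∀ {A} → Ψ ⊢ A → Ψ A
  Ψ-closed d = Ψ∪-consistent⇒∈ (λ d′ → Ψ-consistent (mp (deduction d′) d))

  Ψ-prime : ∀ A B → Ψ (A ∨ B) → Ψ A ⊎ Ψ B
  Ψ-prime A B A∨B with em {Ψ A} | em {Ψ B}
  ... | yes a | _     = inj₁ a
  ... | no _  | yes b = inj₂ b
  ... | no ∉A | no ∉B = ⊥-elim (Ψ-consistent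
        (mp (mp (mp (ax ax∨E) (∉Ψ⇒derives ∉A)) (∉Ψ⇒derives ∉B)) (hyp A∨B)))

  extension : FullExtension Γ C
  extension = record
    { Ψ       = Ψ
    ; full    = record { closed = λ _ → Ψ-closed ∘ ⊢CK⇒⊢ ; prime = Ψ-prime }
    ; extends = 0 ,_
    ; avoids  = Ψ-consistent ∘ hyp
    }

-- The set of all formulas is a successor witnessing every ◇-formula.
segment : (Ψ : FmSet) → Full Ψ → Wᶜ
segment Ψ full = record
  { Φ      = Ψ
  ; 𝒰      = λ Θ → Full Θ × □⁻¹ Ψ ⊆ Θ
  ; Φ-full = full
  ; 𝒰-full = λ _ → proj₁
  ; □-cond = λ A □A _ Θ∈𝒰 → proj₂ Θ∈𝒰 □A
  ; ◇-cond = λ _ _ → U , (full-U , _) , tt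
  }

module Counterexamples (em : ExcludedMiddle lzero) (w : Wᶜ) where

  private
    extend : (Γ : FmSet) (C : Fm) → ¬ Γ ⊢ C → FullExtension Γ C
    extend = Lindenbaum.extension em

  ⇒-counterexample : ∀ {B C} → ¬ Φ w (B ⇒ C) →
    Σ Wᶜ λ v → w ≤ᶜ v × Φ v B × ¬ Φ v C
  ⇒-counterexample {B} {C} ∉w =
    segment Ψ full , (λ _ → extends ∘ inj₁) , extends (inj₂ refl) , avoids
    where
    open FullExtension (extend (Φ w ∪ ｛ B ｝) C (∉w ∘ full-⊢ (Φ-full w) ∘ deduction))

  □-counterexample : ∀ {B} → ¬ Φ w (□ B) →
    Σ Wᶜ λ u → Rᶜ (segment (Φ w) (Φ-full w)) u × ¬ Φ u B
  □-counterexample {B} ∉w = segment Ψ full , (full , extends) , avoids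
    where
    open FullExtension (extend (□⁻¹ (Φ w)) B (∉w ∘ full-⊢ (Φ-full w) ∘ □-intro))

  ◇-counterexample : ∀ {B} → ¬ Φ w (◇ B) →
    Σ Wᶜ λ v → w ≤ᶜ v × (∀ u → Rᶜ v u → ¬ Φ u B)
  ◇-counterexample {B} ∉w = v , (λ _ → id) , λ _ → proj₂ ∘ proj₂
    where
    successor : ∀ A → Φ w (◇ A) → Σ FmSet λ Θ → (Full Θ × □⁻¹ (Φ w) ⊆ Θ × ¬ Θ B) × Θ A
    successor A ◇A = Ψ , (full , extends ∘ inj₁ , avoids) , extends (inj₂ refl)
      where
      open FullExtension (extend (□⁻¹ (Φ w) ∪ ｛ A ｝) B
                                 (λ d → ∉w (full-⊢ (Φ-full w) (◇-intro d ◇A))))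
    v : Wᶜ
    v = record
      { Φ      = Φ w
      ; 𝒰      = λ Θ → Full Θ × □⁻¹ (Φ w) ⊆ Θ × ¬ Θ B
      ; Φ-full = Φ-full w
      ; 𝒰-full = λ _ → proj₁
      ; □-cond = λ A □A _ Θ∈𝒰 → proj₁ (proj₂ Θ∈𝒰) □A
      ; ◇-cond = successor
      }

module _ (em : ExcludedMiddle lzero) where

  open Equivalence

  truth-lemma : ∀ A (w : Wᶜ) → (w ⊩ A) ⇔ Φ w A
  truth-lemma (var p) w = mk⇔ lower lift
  truth-lemma ⊥'      w = mk⇔ lower lift
  truth-lemma (B ∧ C) w = mk⇔
    (λ (b , c) → full-⊢ (Φ-full w) (∧-intro (hyp (to (truth-lemma B w) b))
                                            (hyp (to (truth-lemma C w) c))))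
    (λ B∧C → from (truth-lemma B w) (full-⊢ (Φ-full w) (mp (ax ax∧₁) (hyp B∧C))) ,
             from (truth-lemma C w) (full-⊢ (Φ-full w) (mp (ax ax∧₂) (hyp B∧C))))
  truth-lemma (B ∨ C) w = mk⇔
    (Sum.[ (λ b → full-⊢ (Φ-full w) (mp (ax ax∨₁) (hyp (to (truth-lemma B w) b))))
         , (λ c → full-⊢ (Φ-full w) (mp (ax ax∨₂) (hyp (to (truth-lemma C w) c)))) ])
    (Sum.map (from (truth-lemma B w)) (from (truth-lemma C w)) ∘ Full.prime (Φ-full w) B C)
  truth-lemma (B ⇒ C) w = mk⇔
    (λ ⊩B⇒C → em⇒dne em λ ∉w →
      let v , w≤v , B∈v , C∉v = ⇒-counterexample ∉w
      in C∉v (to (truth-lemma C v) (⊩B⇒C v w≤v (from (truth-lemma B v) B∈v))))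
    (λ B⇒C v w≤v ⊩B → from (truth-lemma C v)
      (full-⊢ (Φ-full v) (mp (hyp (w≤v _ B⇒C)) (hyp (to (truth-lemma B v) ⊩B)))))
    where open Counterexamples em w
  truth-lemma (□ B) w = mk⇔
    (λ ⊩□B → em⇒dne em λ ∉w →
      let u , wRu , B∉u = □-counterexample ∉w
      in B∉u (to (truth-lemma B u) (⊩□B (segment (Φ w) (Φ-full w)) (λ _ → id) u wRu)))
    (λ □B v w≤v u vRu → from (truth-lemma B u) (□-cond v B (w≤v _ □B) (Φ u) vRu))
    where open Counterexamples em w
  truth-lemma (◇ B) w = mk⇔
    (λ (⊩◇B : w ⊩ ◇ B) → em⇒dne em λ ∉w →
      let v , w≤v , B∉succ = ◇-counterexample ∉w
          u , vRu , ⊩B = ⊩◇B v w≤v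
      in B∉succ u vRu (to (truth-lemma B u) ⊩B))
    (λ ◇B v w≤v →
      let Θ , Θ∈𝒰 , B∈Θ = ◇-cond v B (w≤v _ ◇B)
          u = segment Θ (𝒰-full v Θ Θ∈𝒰)
      in u , Θ∈𝒰 , from (truth-lemma B u) B∈Θ)
    where open Counterexamples em w

canonical-isConstructiveBirelational : IsConstructiveBirelational Wᶜ _≤ᶜ_ Fᶜ Rᶜ Vᶜ
canonical-isConstructiveBirelational = record
  { nonempty = segment U full-U
  ; ≤-refl   = λ _ _ → id
  ; ≤-trans  = λ _ _ _ u≤v v≤w A → v≤w A ∘ u≤v A
  ; F-up     = λ _ _ w≤v → w≤v ⊥'
  ; V-up     = λ p _ _ w≤v → w≤v (var p)
  ; F-atoms  = λ w ⊥∈w _ → full-explosion (Φ-full w) ⊥∈w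
  ; F-R      = λ w ⊥∈w v wRv → □-cond w ⊥' (full-explosion (Φ-full w) ⊥∈w) (Φ v) wRv
  ; F-serial = λ w ⊥∈w →
      let Θ , Θ∈𝒰 , _ = ◇-cond w ⊥' (full-explosion (Φ-full w) ⊥∈w)
      in segment Θ (𝒰-full w Θ Θ∈𝒰) , Θ∈𝒰
  }

mainTheorem10 : (∀ {ℓ} → ExcludedMiddle ℓ) →
    ((w : Wᶜ) (A : Fm) → (w ⊩ A) ⇔ Φ w A)
    × IsConstructiveBirelational Wᶜ _≤ᶜ_ Fᶜ Rᶜ Vᶜ
mainTheorem10 em = (λ w A → truth-lemma em A w) , canonical-isConstructiveBirelational
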